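{- Let $\pi=[\pi_1,\dots,\pi_n]$ be a permutation of $\{1,\dots,n\}$, extended by $\pi_0=0$ and $\pi_{n+1}=n+1$. Applying a monotone block move to $\pi$ decreases the number of descents by at most one and decreases the number of gaps by at most two.
   Context: A block move $(i,j,k)$ with $1\le i\le j<k\le n$ maps $[\dots\pi_{i-1}\,\pi_i\dots\pi_j\,\pi_{j+1}\dots\pi_k\,\pi_{k+1}\dots]$ to $[\dots\pi_{i-1}\,\pi_{j+1}\dots\pi_k\,\pi_i\dots\pi_j\,\pi_{k+1}\dots]$ (the elements $\pi_0,\pi_{n+1}$ are never moved). It is monotone if $\pi_q>\pi_r$ for all $i\le q\le j<r\le k$. For $0\le i\le n$, the ordered pair $(\pi_i,\pi_{i+1})$ of adjacent elements is a good pair if $\pi_{i+1}=\pi_i+1$ and a breakpoint otherwise; a breakpoint is a descent if $\pi_i>\pi_{i+1}$ and a gap otherwise. -}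

module Defs where

open import Data.Nat using (ℕ; zero; suc; _+_; _∸_; _<_; _≤_; _>_; _<?_; _≟_)
open import Data.Nat.Properties using (_<?_)
open import Data.Fin using (Fin; toℕ; fromℕ<)
open import Data.Fin.Permutation using (Permutation′; _⟨$⟩ʳ_)
open import Data.List using (List; length; filter; upTo)
open import Data.Product using (_×_)
open import Relation.Nullary using (¬_; Dec; yes; no)
open import Relation.Nullary.Decidable using (_×-dec_; ¬?)

-- A permutation π of {1,…,n} is given as a bijection π : Fin n ↔ Fin n;
-- the value π_p (1 ≤ p ≤ n) is  1 + toℕ (π ⟨$⟩ʳ (p-1)).
-- Extended sequence (positions 0 … n+1): π_0 = 0, π_{n+1} = n+1.
-- (Positions > n+1 are never used; they are assigned n+1.)
ext : ∀ {n} → Permutation′ n → ℕ → ℕ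
ext π zero = 0
ext {n} π (suc p) with p <? n
... | yes lt = suc (toℕ (π ⟨$⟩ʳ fromℕ< lt))
... | no _  = suc n

-- Block move (i,j,k) acting on a sequence σ indexed by positions:
-- positions i … k are rearranged to  σ_{j+1} … σ_k σ_i … σ_j.
blockMove : ℕ → ℕ → ℕ → (ℕ → ℕ) → (ℕ → ℕ)
blockMove i j k σ p with p <? i | k <? p
... | yes _ | _     = σ p
... | no _  | yes _ = σ p
... | no _  | no _  with p <? i + (k ∸ j)
...   | yes _ = σ (suc j + (p ∸ i))
...   | no _  = σ (i + (p ∸ i ∸ (k ∸ j)))

Monotone : ℕ → ℕ → ℕ → (ℕ → ℕ) → Set
Monotone i j k σ = ∀ q r → i ≤ q → q ≤ j → j < r → r ≤ k → σ q > σ r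

Descent : (ℕ → ℕ) → ℕ → Set
Descent σ p = σ p > σ (suc p)

Gap : (ℕ → ℕ) → ℕ → Set
Gap σ p = (σ p < σ (suc p)) × ¬ (σ (suc p) ≡ suc (σ p))
  where open import Relation.Binary.PropositionalEquality using (_≡_)

descent? : ∀ σ p → Dec (Descent σ p)
descent? σ p = σ (suc p) <? σ p

gap? : ∀ σ p → Dec (Gap σ p)
gap? σ p = (σ p <? σ (suc p)) ×-dec ¬? (σ (suc p) ≟ suc (σ p))

descents : ℕ → (ℕ → ℕ) → ℕ
descents n σ = length (filter (descent? σ) (upTo (suc n)))

gaps : ℕ → (ℕ → ℕ) → ℕ
gaps n σ = length (filter (gap? σ) (upTo (suc n)))

-- A block move (i,j,k) changes only three adjacencies: (π_{i-1},π_i), (π_j,π_{j+1}) and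
-- (π_k,π_{k+1}) are replaced by (π_{i-1},π_{j+1}), (π_k,π_i) and (π_j,π_{k+1}), while every
-- other adjacent pair survives inside one of the four untouched segments. So for any
-- property of pairs the count changes by (new junctions) − (old junctions). If the move is
-- monotone, (π_j,π_{j+1}) is a descent, and π_i > π_{j+1}, π_j > π_k make the other two old
-- junctions descents only if the corresponding new ones are: at most one descent is lost.
-- The old junction (π_j,π_{j+1}) is not a gap, so at most two gaps are lost.
module Submission where

open import Defs
open import Data.Nat using (ℕ; zero; suc; _+_; _∸_; _≤_; _<_; _>_; z≤n; s≤s; _<?_; _≟_)
open import Data.Nat.Properties
open import Data.Nat.Tactic.RingSolver using (solve-∀)
open import Algebra.Properties.CommutativeSemigroup +-commutativeSemigroup using (xy∙z≈xz∙y)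
open import Data.List using (length; filter; upTo; applyUpTo)
open import Data.Product using (_×_; _,_; proj₁)
open import Data.Fin.Permutation using (Permutation′)
open import Relation.Nullary using (¬_; Dec; yes; no; contradiction)
open import Relation.Nullary.Decidable using (_×-dec_; ¬?)
open import Relation.Binary.PropositionalEquality
open import Function using (_∘_; id)

x+v≡y+u∧u≤v+e⇒x≤y+e : ∀ {x y u v} e → x + v ≡ y + u → u ≤ v + e → x ≤ y + e
x+v≡y+u∧u≤v+e⇒x≤y+e {x} {y} {u} {v} e x+v≡y+u u≤v+e = +-cancelʳ-≤ v x (y + e) (begin
  x + v        ≡⟨ x+v≡y+u ⟩
  y + u        ≤⟨ +-monoʳ-≤ y u≤v+e ⟩
  y + (v + e)  ≡⟨ cong (y +_) (+-comm v e) ⟩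
  y + (e + v)  ≡⟨ +-assoc y e v ⟨
  y + e + v    ∎)
  where open ≤-Reasoning

blockMove-before : ∀ i j k σ p → p < i → blockMove i j k σ p ≡ σ p
blockMove-before i j k σ p p<i with p <? i
... | yes _  = refl
... | no p≮i = contradiction p<i p≮i

blockMove-after : ∀ i j k σ p → i ≤ k → k < p → blockMove i j k σ p ≡ σ p
blockMove-after i j k σ p i≤k k<p with p <? i | k <? p
... | yes p<i | _      = contradiction (<-trans p<i (≤-<-trans i≤k k<p)) (<-irrefl refl)
... | no _    | yes _  = refl
... | no _    | no k≮p = contradiction k<p k≮p

blockMove-front : ∀ i j k σ p → i ≤ p → p < i + (k ∸ j) → p ≤ k →
                  blockMove i j k σ p ≡ σ (suc j + (p ∸ i))
blockMove-front i j k σ p i≤p p<front p≤k with p <? i | k <? p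
... | yes p<i | _     = contradiction i≤p (<⇒≱ p<i)
... | no _    | yes k<p = contradiction p≤k (<⇒≱ k<p)
... | no _    | no _ with p <? i + (k ∸ j)
...   | yes _ = refl
...   | no p≮front = contradiction p<front p≮front

blockMove-back : ∀ i j k σ p → i + (k ∸ j) ≤ p → p ≤ k →
                 blockMove i j k σ p ≡ σ (i + (p ∸ i ∸ (k ∸ j)))
blockMove-back i j k σ p front≤p p≤k with p <? i | k <? p
... | yes p<i | _     = contradiction (≤-trans (m≤m+n i _) front≤p) (<⇒≱ p<i)
... | no _    | yes k<p = contradiction p≤k (<⇒≱ k<p)
... | no _    | no _ with p <? i + (k ∸ j)
...   | yes p<front = contradiction front≤p (<⇒≱ p<front)
...   | no _ = refl

module Adjacencies {R : ℕ → ℕ → Set} (R? : ∀ x y → Dec (R x y)) where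

  χ : ℕ → ℕ → ℕ
  χ x y with R? x y
  ... | yes _ = 1
  ... | no _  = 0

  χ≤1 : ∀ x y → χ x y ≤ 1
  χ≤1 x y with R? x y
  ... | yes _ = ≤-refl
  ... | no _  = z≤n

  χ-yes : ∀ {x y} → R x y → χ x y ≡ 1
  χ-yes {x} {y} r with R? x y
  ... | yes _ = refl
  ... | no ¬r = contradiction r ¬r

  χ-no : ∀ {x y} → ¬ R x y → χ x y ≡ 0
  χ-no {x} {y} ¬r with R? x y
  ... | yes r = contradiction r ¬r
  ... | no _  = refl

  χ-mono : ∀ {x y x′ y′} → (R x y → R x′ y′) → χ x y ≤ χ x′ y′
  χ-mono {x} {y} {x′} {y′} f with R? x y | R? x′ y′
  ... | yes r | no ¬r′ = contradiction (f r) ¬r′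
  ... | yes _ | yes _  = ≤-refl
  ... | no _  | _      = z≤n

  count : ℕ → (ℕ → ℕ) → ℕ
  count N σ = length (filter (λ p → R? (σ p) (σ (suc p))) (upTo N))

  countFrom : (ℕ → ℕ) → ℕ → ℕ → ℕ
  countFrom σ a zero    = 0
  countFrom σ a (suc m) = χ (σ a) (σ (suc a)) + countFrom σ (suc a) m

  count-applyUpTo : ∀ σ {a} m f → (∀ t → f t ≡ a + t) →
    length (filter (λ p → R? (σ p) (σ (suc p))) (applyUpTo f m)) ≡ countFrom σ a m
  count-applyUpTo σ zero    f f≗a+ = refl
  count-applyUpTo σ {a} (suc m) f f≗a+
    rewrite f≗a+ 0 | +-identityʳ a | sym (count-applyUpTo σ m (f ∘ suc) (λ t → trans (f≗a+ (suc t)) (+-suc a t)))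
    with R? (σ a) (σ (suc a))
  ... | yes _ = refl
  ... | no _  = refl

  count≡countFrom : ∀ N σ → count N σ ≡ countFrom σ 0 N
  count≡countFrom N σ = count-applyUpTo σ N id (λ _ → refl)

  countFrom-split : ∀ σ a m l {b} → a + m ≡ b →
    countFrom σ a (m + suc l) ≡ countFrom σ a m + (χ (σ b) (σ (suc b)) + countFrom σ (suc b) l)
  countFrom-split σ a zero    l refl rewrite +-identityʳ a = refl
  countFrom-split σ a (suc m) l a+sm≡b =
    trans (cong (χ (σ a) (σ (suc a)) +_) (countFrom-split σ (suc a) m l (trans (sym (+-suc a m)) a+sm≡b)))
          (sym (+-assoc (χ (σ a) (σ (suc a))) _ _))

  countFrom-cong : ∀ σ τ a b m → (∀ t → t ≤ m → σ (a + t) ≡ τ (b + t)) →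
                   countFrom σ a m ≡ countFrom τ b m
  countFrom-cong σ τ a b zero    agree = refl
  countFrom-cong σ τ a b (suc m) agree = cong₂ _+_
    (cong₂ χ (at 0 z≤n) (at 1 (s≤s z≤n)))
    (countFrom-cong σ τ (suc a) (suc b) m λ t t≤m →
      trans (cong σ (sym (+-suc a t))) (trans (agree (suc t) (s≤s t≤m)) (cong τ (+-suc b t))))
    where
    at : ∀ t → t ≤ suc m → σ (t + a) ≡ τ (t + b)
    at t t≤ = trans (cong σ (+-comm t a)) (trans (agree t t≤) (cong τ (+-comm b t)))

module BlockMove (σ : ℕ → ℕ) (h a b : ℕ) where

  i j k : ℕ
  i = suc h
  j = i + a
  k = suc j + b

  moved : ℕ → ℕ
  moved = blockMove i j k σ

  k∸j≡1+b : k ∸ j ≡ suc b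
  k∸j≡1+b = trans (cong (_∸ j) (sym (+-suc j b))) (m+n∸m≡n j (suc b))

  i≤k : i ≤ k
  i≤k = ≤-trans (m≤m+n i a) (≤-trans (n≤1+n j) (m≤m+n (suc j) b))

  1+i+b+a≡k : suc (i + b) + a ≡ k
  1+i+b+a≡k = cong suc (xy∙z≈xz∙y i b a)

  moved-before : ∀ p → p < i → moved p ≡ σ p
  moved-before = blockMove-before i j k σ

  moved-after : ∀ p → k < p → moved p ≡ σ p
  moved-after p = blockMove-after i j k σ p i≤k

  moved-front : ∀ t → t ≤ b → moved (i + t) ≡ σ (suc j + t)
  moved-front t t≤b = begin
    moved (i + t)                ≡⟨ blockMove-front i j k σ (i + t) (m≤m+n i t) i+t<front i+t≤k ⟩
    σ (suc j + (i + t ∸ i))      ≡⟨ cong (σ ∘ (suc j +_)) (m+n∸m≡n i t) ⟩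
    σ (suc j + t)                ∎
    where
    open ≡-Reasoning
    i+t<front : i + t < i + (k ∸ j)
    i+t<front = subst (λ d → i + t < i + d) (sym k∸j≡1+b) (+-monoʳ-< i (s≤s t≤b))
    i+t≤k : i + t ≤ k
    i+t≤k = ≤-trans (+-monoʳ-≤ i t≤b) (≤-trans (n≤1+n (i + b)) (≤-trans (m≤m+n _ a) (≤-reflexive 1+i+b+a≡k)))

  moved-back : ∀ t → t ≤ a → moved (suc (i + b) + t) ≡ σ (i + t)
  moved-back t t≤a = begin
    moved p                            ≡⟨ blockMove-back i j k σ p front≤p p≤k ⟩
    σ (i + (p ∸ i ∸ (k ∸ j)))          ≡⟨ cong (λ d → σ (i + (p ∸ i ∸ d))) k∸j≡1+b ⟩
    σ (i + (p ∸ i ∸ suc b))            ≡⟨ cong (σ ∘ (i +_)) (∸-+-assoc p i (suc b)) ⟩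
    σ (i + (p ∸ (i + suc b)))          ≡⟨ cong (λ q → σ (i + (q ∸ (i + suc b)))) p≡i+1+b+t ⟩
    σ (i + (i + suc b + t ∸ (i + suc b))) ≡⟨ cong (σ ∘ (i +_)) (m+n∸m≡n (i + suc b) t) ⟩
    σ (i + t)                          ∎
    where
    open ≡-Reasoning
    p : ℕ
    p = suc (i + b) + t
    p≡i+1+b+t : p ≡ i + suc b + t
    p≡i+1+b+t = cong (_+ t) (sym (+-suc i b))
    front≤p : i + (k ∸ j) ≤ p
    front≤p = subst (λ d → i + d ≤ p) (sym k∸j≡1+b) (≤-trans (≤-reflexive (+-suc i b)) (m≤m+n _ t))
    p≤k : p ≤ k
    p≤k = ≤-trans (+-monoʳ-≤ (suc (i + b)) t≤a) (≤-reflexive 1+i+b+a≡k)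

  moved-i : moved i ≡ σ (suc j)
  moved-i = trans (cong moved (sym (+-identityʳ i))) (trans (moved-front 0 z≤n) (cong σ (+-identityʳ (suc j))))

  moved-1+i+b : moved (suc (i + b)) ≡ σ i
  moved-1+i+b = trans (cong moved (sym (+-identityʳ (suc (i + b))))) (trans (moved-back 0 z≤n) (cong σ (+-identityʳ i)))

  moved-k : moved k ≡ σ j
  moved-k = trans (cong moved (sym 1+i+b+a≡k)) (moved-back a ≤-refl)

  module _ {R : ℕ → ℕ → Set} (R? : ∀ x y → Dec (R x y)) (c : ℕ) where
    open Adjacencies R?

    oldJunctions newJunctions segments : ℕ
    oldJunctions = χ (σ h) (σ i) + χ (σ j) (σ (suc j)) + χ (σ k) (σ (suc k))
    newJunctions = χ (σ h) (σ (suc j)) + χ (σ k) (σ i) + χ (σ j) (σ (suc k))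
    segments = countFrom σ 0 h + countFrom σ i a + countFrom σ (suc j) b + countFrom σ (suc k) c

    private
      interleave : ∀ x u y v z w s → x + (u + (y + (v + (z + (w + s))))) ≡ (x + y + z + s) + (u + v + w)
      interleave = solve-∀

      positions : ∀ h a b c → suc (suc (suc h + a) + b + c) ≡ h + suc (a + suc (b + suc c))
      positions = solve-∀

      positions-moved : ∀ h a b c → suc (suc (suc h + a) + b + c) ≡ h + suc (b + suc (a + suc c))
      positions-moved = solve-∀

    count-σ : count (suc (k + c)) σ ≡ segments + oldJunctions
    count-σ = begin
      count (suc (k + c)) σ
        ≡⟨ count≡countFrom _ σ ⟩
      countFrom σ 0 (suc (k + c))
        ≡⟨ cong (countFrom σ 0) (positions h a b c) ⟩
      countFrom σ 0 (h + suc (a + suc (b + suc c)))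
        ≡⟨ countFrom-split σ 0 h _ refl ⟩
      _ ≡⟨ cong (λ z → X + (χ (σ h) (σ i) + z)) (countFrom-split σ i a _ refl) ⟩
      _ ≡⟨ cong (λ z → X + (χ (σ h) (σ i) + (Y + (χ (σ j) (σ (suc j)) + z)))) (countFrom-split σ (suc j) b _ refl) ⟩
      _ ≡⟨ interleave X (χ (σ h) (σ i)) Y (χ (σ j) (σ (suc j))) (countFrom σ (suc j) b) (χ (σ k) (σ (suc k))) (countFrom σ (suc k) c) ⟩
      segments + oldJunctions ∎
      where
      open ≡-Reasoning
      X Y : ℕ
      X = countFrom σ 0 h
      Y = countFrom σ i a

    count-moved : count (suc (k + c)) moved ≡ segments + newJunctions
    count-moved = begin
      count (suc (k + c)) moved
        ≡⟨ count≡countFrom _ moved ⟩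
      countFrom moved 0 (suc (k + c))
        ≡⟨ cong (countFrom moved 0) (positions-moved h a b c) ⟩
      countFrom moved 0 (h + suc (b + suc (a + suc c)))
        ≡⟨ countFrom-split moved 0 h _ refl ⟩
      _ ≡⟨ cong (λ z → X + (χ (moved h) (moved i) + z)) (countFrom-split moved i b _ refl) ⟩
      _ ≡⟨ cong (λ z → X + (χ (moved h) (moved i) + (Z + (χ (moved (i + b)) (moved (suc (i + b))) + z))))
                (countFrom-split moved (suc (i + b)) a _ 1+i+b+a≡k) ⟩
      _ ≡⟨ interleave X (χ (moved h) (moved i)) Z (χ (moved (i + b)) (moved (suc (i + b)))) Y (χ (moved k) (moved (suc k))) W ⟩
      (X + Z + Y + W) + (χ (moved h) (moved i) + χ (moved (i + b)) (moved (suc (i + b))) + χ (moved k) (moved (suc k)))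
        ≡⟨ cong₂ _+_ segments-agree junctions-agree ⟩
      segments + newJunctions ∎
      where
      open ≡-Reasoning
      X Y Z W : ℕ
      X = countFrom moved 0 h
      Z = countFrom moved i b
      Y = countFrom moved (suc (i + b)) a
      W = countFrom moved (suc k) c
      segments-agree : X + Z + Y + W ≡ segments
      segments-agree = cong₂ _+_
        (trans (xy∙z≈xz∙y X Z Y) (cong₂ _+_
          (cong₂ _+_ (countFrom-cong moved σ 0 0 h λ t t≤h → moved-before t (s≤s t≤h))
                     (countFrom-cong moved σ (suc (i + b)) i a moved-back))
          (countFrom-cong moved σ i (suc j) b moved-front)))
        (countFrom-cong moved σ (suc k) (suc k) c λ t _ → moved-after (suc k + t) (s≤s (m≤m+n k t)))
      junctions-agree : χ (moved h) (moved i) + χ (moved (i + b)) (moved (suc (i + b))) + χ (moved k) (moved (suc k))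
                      ≡ newJunctions
      junctions-agree = cong₂ _+_
        (cong₂ _+_ (cong₂ χ (moved-before h ≤-refl) moved-i) (cong₂ χ (moved-front b ≤-refl) moved-1+i+b))
        (cong₂ χ moved-k (moved-after (suc k) ≤-refl))

    count-blockMove : count (suc (k + c)) σ + newJunctions ≡ count (suc (k + c)) moved + oldJunctions
    count-blockMove = begin
      count (suc (k + c)) σ + newJunctions      ≡⟨ cong (_+ newJunctions) count-σ ⟩
      segments + oldJunctions + newJunctions    ≡⟨ xy∙z≈xz∙y segments oldJunctions newJunctions ⟩
      segments + newJunctions + oldJunctions    ≡⟨ cong (_+ oldJunctions) count-moved ⟨
      count (suc (k + c)) moved + oldJunctions  ∎
      where open ≡-Reasoning

    count-≤-count-blockMove : ∀ e → oldJunctions ≤ newJunctions + e →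
                              count (suc (k + c)) σ ≤ count (suc (k + c)) moved + e
    count-≤-count-blockMove e = x+v≡y+u∧u≤v+e⇒x≤y+e e count-blockMove

descentPair? : ∀ x y → Dec (y < x)
descentPair? x y = y <? x

gapPair? : ∀ x y → Dec (x < y × ¬ y ≡ suc x)
gapPair? x y = (x <? y) ×-dec ¬? (y ≟ suc x)

module MonotoneBlockMove (σ : ℕ → ℕ) (h a b : ℕ) (mono : Monotone (suc h) (suc h + a) (suc (suc h + a) + b) σ) where
  open BlockMove σ h a b

  σi>σ1+j : σ i > σ (suc j)
  σi>σ1+j = mono i (suc j) ≤-refl (m≤m+n i a) ≤-refl (s≤s (m≤m+n j b))

  σj>σ1+j : σ j > σ (suc j)
  σj>σ1+j = mono j (suc j) (m≤m+n i a) ≤-refl ≤-refl (s≤s (m≤m+n j b))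

  σj>σk : σ j > σ k
  σj>σk = mono j k (m≤m+n i a) ≤-refl (s≤s (m≤m+n j b)) ≤-refl

  descents-blockMove : ∀ c → descents (k + c) σ ≤ descents (k + c) moved + 1
  descents-blockMove c = count-≤-count-blockMove descentPair? c 1 (begin
    χ (σ h) (σ i) + χ (σ j) (σ (suc j)) + χ (σ k) (σ (suc k))
      ≡⟨ cong (λ d → χ (σ h) (σ i) + d + χ (σ k) (σ (suc k))) (χ-yes σj>σ1+j) ⟩
    χ (σ h) (σ i) + 1 + χ (σ k) (σ (suc k))
      ≤⟨ +-mono-≤ (+-monoˡ-≤ 1 (χ-mono (<-trans σi>σ1+j))) (χ-mono (λ σ1+k<σk → <-trans σ1+k<σk σj>σk)) ⟩
    v₁ + 1 + v₃
      ≡⟨ xy∙z≈xz∙y v₁ 1 v₃ ⟩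
    v₁ + v₃ + 1
      ≤⟨ +-monoˡ-≤ 1 (+-monoˡ-≤ v₃ (m≤m+n v₁ v₂)) ⟩
    v₁ + v₂ + v₃ + 1 ∎)
    where
    open Adjacencies descentPair?
    open ≤-Reasoning
    v₁ v₂ v₃ : ℕ
    v₁ = χ (σ h) (σ (suc j))
    v₂ = χ (σ k) (σ i)
    v₃ = χ (σ j) (σ (suc k))

  gaps-blockMove : ∀ c → gaps (k + c) σ ≤ gaps (k + c) moved + 2
  gaps-blockMove c = count-≤-count-blockMove gapPair? c 2 (begin
    χ (σ h) (σ i) + χ (σ j) (σ (suc j)) + χ (σ k) (σ (suc k))
      ≡⟨ cong (λ d → χ (σ h) (σ i) + d + χ (σ k) (σ (suc k))) (χ-no (λ gap → <-asym (proj₁ gap) σj>σ1+j)) ⟩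
    χ (σ h) (σ i) + 0 + χ (σ k) (σ (suc k))
      ≤⟨ +-mono-≤ (+-monoˡ-≤ 0 (χ≤1 (σ h) (σ i))) (χ≤1 (σ k) (σ (suc k))) ⟩
    2
      ≤⟨ m≤n+m 2 (newJunctions gapPair? c) ⟩
    newJunctions gapPair? c + 2 ∎)
    where
    open Adjacencies gapPair?
    open ≤-Reasoning

lemma1 : ∀ (n : ℕ) (π : Permutation′ n) (i j k : ℕ) →
    1 ≤ i → i ≤ j → j < k → k ≤ n →
    Monotone i j k (ext π) →
    (descents n (ext π) ≤ descents n (blockMove i j k (ext π)) + 1)
    × (gaps n (ext π) ≤ gaps n (blockMove i j k (ext π)) + 2)
lemma1 n π i j k 1≤i i≤j j<k k≤n mono
  with m≤n⇒∃[o]m+o≡n 1≤i | m≤n⇒∃[o]m+o≡n i≤j | m≤n⇒∃[o]m+o≡n j<k | m≤n⇒∃[o]m+o≡n k≤n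
... | h , refl | a , refl | b , refl | c , refl =
  descents-blockMove c , gaps-blockMove c
  where open MonotoneBlockMove (ext π) h a b mono
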